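{- Let $T$ be a tree on an even number $n$ of vertices with domination number $\gamma(T)=\frac{n}{2}$. If $D$ is a minimum dominating set of $T$, then $V(T)\setminus D$ is also a minimum dominating set of $T$.
   Context: A set $D\subseteq V(T)$ is dominating if every vertex outside $D$ has a neighbor in $D$; the domination number $\gamma(T)$ is the minimum size of a dominating set, and a minimum dominating set is a dominating set of size $\gamma(T)$. -}

module Defs where

open import Data.Nat using (ℕ; zero; suc; _+_; _*_; _≤_; _≥_)
open import Data.Fin using (Fin)
open import Data.Fin.Subset using (Subset; _∈_; _∉_; ∣_∣; ∁)
open import Data.Bool using (Bool; true; false; T)
open import Data.List using (List; []; _∷_; length)
open import Data.List.Relation.Unary.Unique.Propositional using (Unique)
open import Data.Product using (Σ; _×_; ∃; ∃-syntax)
open import Relation.Binary.PropositionalEquality using (_≡_)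
open import Relation.Nullary using (¬_)

record Graph (n : ℕ) : Set where
  field
    adj      : Fin n → Fin n → Bool
    symmetric : ∀ u v → adj u v ≡ adj v u
    irreflexive : ∀ v → adj v v ≡ false

open Graph public

Adj : ∀ {n} → Graph n → Fin n → Fin n → Set
Adj G u v = T (adj G u v)

data Walk {n : ℕ} (G : Graph n) : Fin n → Fin n → Set where
  nil  : ∀ {v} → Walk G v v
  cons : ∀ {u w v} → Adj G u w → Walk G w v → Walk G u v

Connected : ∀ {n} → Graph n → Set
Connected G = ∀ u v → Walk G u v

ConsecAdj : ∀ {n} → Graph n → Fin n → List (Fin n) → Fin n → Set
ConsecAdj G x [] last = x ≡ last
ConsecAdj G x (y ∷ ys) last = Adj G x y × ConsecAdj G y ys last

-- A cycle: distinct vertices x, x₁, …, x_k (at least 3 vertices in total),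
-- consecutive ones adjacent, and the last one adjacent to x.
HasCycle : ∀ {n} → Graph n → Set
HasCycle {n} G =
  Σ (Fin n) λ x → Σ (List (Fin n)) λ xs → Σ (Fin n) λ last →
    (2 ≤ length xs) × Unique (x ∷ xs) × ConsecAdj G x xs last × Adj G last x

IsTree : ∀ {n} → Graph n → Set
IsTree G = Connected G × ¬ HasCycle G

Dominating : ∀ {n} → Graph n → Subset n → Set
Dominating {n} G D = ∀ v → v ∉ D → ∃[ u ] (u ∈ D × Adj G v u)

MinDominating : ∀ {n} → Graph n → Subset n → Set
MinDominating G D = Dominating G D × (∀ D′ → Dominating G D′ → ∣ D ∣ ≤ ∣ D′ ∣)

DominationNumber : ∀ {n} → Graph n → ℕ → Set
DominationNumber G m =
  (∃[ D ] (Dominating G D × ∣ D ∣ ≡ m)) × (∀ D → Dominating G D → m ≤ ∣ D ∣)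

{-# OPTIONS --safe #-}
module Submission where

-- The hypothesis γ(T) = n/2 makes ∁ D as large as D, so it is minimum as soon as it
-- is dominating. That is Ore's observation: if some v ∈ D had all its neighbours in D,
-- then D - v would still dominate (v via any neighbour, which exists because a connected
-- graph on n ≥ 2 vertices has no isolated vertex), contradicting the minimality of D.

open import Defs
open import Data.Nat using (ℕ; zero; suc; z≤n; s≤s; _*_; _+_; _∸_; _≤_)
open import Data.Nat.Properties using (m+n∸m≡n; +-identityʳ; ≤-antisym; <⇒≱; *-monoʳ-≤)
open import Data.Fin using (Fin; zero; punchIn; _≟_)
open import Data.Fin.Properties using (any?; punchInᵢ≢i)
open import Data.Fin.Subset using (Subset; ∁; _∈_; _∉_; ∣_∣; _-_)
open import Data.Fin.Subset.Properties
  using (_∈?_; x∉∁p⇒x∈p; ∣∁p∣≡n∸∣p∣; x∈p∧x≢y⇒x∈p-y; x∈p⇒∣p-x∣<∣p∣)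
open import Data.Bool using (T)
open import Data.Empty using (⊥-elim)
open import Function using (_∘_)
open import Data.Product using (_,_; _×_; ∃-syntax)
open import Relation.Nullary using (yes; no)
open import Relation.Nullary.Decidable using (T?; _×-dec_)
open import Relation.Binary.PropositionalEquality
  using (_≡_; refl; sym; cong; cong₂; subst; _≢_; module ≡-Reasoning)

module _ {n : ℕ} (G : Graph n) where

  Adj-sym : ∀ {u v} → Adj G u v → Adj G v u
  Adj-sym {u} {v} = subst T (symmetric G u v)

  Adj⇒≢ : ∀ {u v} → Adj G u v → u ≢ v
  Adj⇒≢ {u} a refl = subst T (irreflexive G u) a

  walk-distinct⇒neighbour : ∀ {v w} → Walk G v w → w ≢ v → ∃[ u ] Adj G v u
  walk-distinct⇒neighbour nil        w≢v = ⊥-elim (w≢v refl)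
  walk-distinct⇒neighbour (cons a _) _   = _ , a

  connected⇒neighbour : Connected G → 2 ≤ n → ∀ v → ∃[ u ] Adj G v u
  connected⇒neighbour conn (s≤s (s≤s z≤n)) v =
    walk-distinct⇒neighbour (conn v (punchIn v zero)) (punchInᵢ≢i v zero)

  dominating-remove : ∀ {D v} → Dominating G D → v ∈ D →
    (∀ u → Adj G v u → u ∈ D) → ∃[ u ] Adj G v u → Dominating G (D - v)
  dominating-remove {D} {v} domD v∈D N[v]⊆D (u , v~u) x x∉D-v with x ≟ v
  ... | yes refl = u , x∈p∧x≢y⇒x∈p-y (N[v]⊆D u v~u) (Adj⇒≢ v~u ∘ sym) , v~u
  ... | no x≢v   = dominator-≢ (domD x x∉D)
    where
    x∉D : x ∉ D
    x∉D x∈D = x∉D-v (x∈p∧x≢y⇒x∈p-y x∈D x≢v)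

    dominator-≢ : ∃[ w ] (w ∈ D × Adj G x w) → ∃[ w ] (w ∈ D - v × Adj G x w)
    dominator-≢ (w , w∈D , x~w) = w , x∈p∧x≢y⇒x∈p-y w∈D w≢v , x~w
      where
      w≢v : w ≢ v
      w≢v refl = x∉D (N[v]⊆D x (Adj-sym x~w))

  MinDominating⇒∁-dominating : (∀ v → ∃[ u ] Adj G v u) →
    ∀ {D} → MinDominating G D → Dominating G (∁ D)
  MinDominating⇒∁-dominating neighbour {D} (domD , minD) v v∉∁D
    with any? (λ u → (u ∈? ∁ D) ×-dec T? (adj G v u))
  ... | yes ∁D-dominator = ∁D-dominator
  ... | no  none = ⊥-elim (<⇒≱ (x∈p⇒∣p-x∣<∣p∣ v∈D) (minD (D - v) domD-v))
    where
    v∈D : v ∈ D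
    v∈D = x∉∁p⇒x∈p v∉∁D

    domD-v : Dominating G (D - v)
    domD-v = dominating-remove domD v∈D
      (λ u v~u → x∉∁p⇒x∈p (λ u∈∁D → none (u , u∈∁D , v~u))) (neighbour v)

  DominationNumber⇒∣MinDominating∣ : ∀ {k D} → DominationNumber G k →
    MinDominating G D → ∣ D ∣ ≡ k
  DominationNumber⇒∣MinDominating∣ ((D₀ , domD₀ , ∣D₀∣≡k) , γ≤) (domD , minD) =
    ≤-antisym (subst (_ ≤_) ∣D₀∣≡k (minD D₀ domD₀)) (γ≤ _ domD)

  DominationNumber⇒MinDominating : ∀ {k D} → DominationNumber G k →
    Dominating G D → ∣ D ∣ ≡ k → MinDominating G D
  DominationNumber⇒MinDominating (_ , γ≤) domD ∣D∣≡k =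
    domD , λ D′ domD′ → subst (_≤ ∣ D′ ∣) (sym ∣D∣≡k) (γ≤ D′ domD′)

∣∁p∣≡half : ∀ {n k} (p : Subset n) → n ≡ 2 * k → ∣ p ∣ ≡ k → ∣ ∁ p ∣ ≡ k
∣∁p∣≡half {n} {k} p n≡2k ∣p∣≡k = begin
  ∣ ∁ p ∣         ≡⟨ ∣∁p∣≡n∸∣p∣ p ⟩
  n ∸ ∣ p ∣       ≡⟨ cong₂ _∸_ n≡2k ∣p∣≡k ⟩
  k + (k + 0) ∸ k ≡⟨ cong (λ m → k + m ∸ k) (+-identityʳ k) ⟩
  k + k ∸ k       ≡⟨ m+n∸m≡n k k ⟩
  k               ∎
  where open ≡-Reasoning

inhabited-even⇒2≤n : ∀ {n k} → n ≡ 2 * k → Fin n → 2 ≤ n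
inhabited-even⇒2≤n {k = zero}  refl ()
inhabited-even⇒2≤n {k = suc k} refl _ = *-monoʳ-≤ 2 (s≤s (z≤n {k}))

lemma2p7 : (n k : ℕ) → n ≡ 2 * k → (G : Graph n) → IsTree G →
    DominationNumber G k → (D : Subset n) → MinDominating G D →
    MinDominating G (∁ D)
lemma2p7 n k n≡2k G (conn , _) γ≡k D minD =
  DominationNumber⇒MinDominating G γ≡k
    (MinDominating⇒∁-dominating G noIsolated minD)
    (∣∁p∣≡half D n≡2k (DominationNumber⇒∣MinDominating∣ G γ≡k minD))
  where
  noIsolated : ∀ v → ∃[ u ] Adj G v u
  noIsolated v = connected⇒neighbour G conn (inhabited-even⇒2≤n {k = k} n≡2k v) v
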